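{- Let $\mathcal E$ be a finitely complete category with a cloven weak factorisation system equipped with a stable functorial choice of diagonal factorisations. Consider the type category with category of contexts $\mathcal E$ whose types over $\Gamma$ are cloven $\mathcal R$-maps $(x,p)\colon X\to\Gamma$, with $\Gamma.A=X$, $\pi_A=x$, and where for $f\colon\Delta\to\Gamma$ the substituted type $A[f]$ is a pullback $y\colon Y\to\Delta$ of $x$ along $f$ (with $f^+\colon Y\to X$ the pullback projection) equipped with the unique cloven $\mathcal R$-map structure making $(f^+,f)$ a morphism of cloven $\mathcal R$-maps. Then this type category has identity types (stable under substitution).
   Context: Cloven w.f.s.: for each $f\colon X\to Y$ a factorisation $f=\rho_f\lambda_f$ through $Pf$; for each commutative square $gh=kf$ a map $P(h,k)\colon Pf\to Pg$ with $P(h,k)\lambda_f=\lambda_gh$, $\rho_gP(h,k)=k\rho_f$, functorial; fillers $\sigma_f\colon Pf\to P\lambda_f$, $\pi_f\colon P\rho_f\to Pf$ with $\sigma_f\lambda_f=\lambda_{\lambda_f}$, $\rho_{\lambda_f}\sigma_f=1$, $\pi_f\lambda_{\rho_f}=1$, $\rho_f\pi_f=\rho_{\rho_f}$. Cloven $\mathcal L$-map $(f,s)$: $s\colon Y\to Pf$, $sf=\lambda_f$, $\rho_fs=1$; cloven $\mathcal R$-map $(f,p)$: $p\colon Pf\to X$, $p\lambda_f=1$, $fp=\rho_f$; morphisms are squares $(h,k)$ with $P(h,k)s=tk$, resp. $qP(h,k)=hp$. A choice of diagonal factorisations assigns to each cloven $\mathcal R$-map $(x,p)\colon X\to\Gamma$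 a factorisation $X\xrightarrow{i_x}I(x)\xrightarrow{j_x}X\times_\Gamma X$ of the diagonal with cloven $\mathcal L$-structure on $i_x$ and cloven $\mathcal R$-structure on $j_x$; functorial if each morphism $(f,g)\colon(x,p)\to(y,q)$ of cloven $\mathcal R$-maps yields, functorially, $I(f,g)\colon I(x)\to I(y)$ with $(f,I(f,g))\colon i_x\to i_y$ a morphism of cloven $\mathcal L$-maps and $(I(f,g),f\times_gf)\colon j_x\to j_y$ a morphism of cloven $\mathcal R$-maps; stable if whenever $(f,g)$ is a pullback square, so is $(I(f,g),f\times_gf)$. A type category (contexts $\mathcal C$, types $\mathrm{Ty}(\Gamma)$, $\pi_A\colon\Gamma.A\to\Gamma$, substitutions $A[f]$, $f^+$ forming pullbacks) has identity types if: writing $B^+=B[\pi_A]$ and $\delta_A\colon\Gamma.A\to\Gamma.A.A^+$ for the diagonal, there are $\mathrm{Id}_A\in\mathrm{Ty}(\Gamma.A.A^+)$, $r_A\colon\Gamma.A\to\Gamma.A.A^+.\mathrm{Id}_A$ with $\pi_{\mathrm{Id}_A}r_A=\delta_A$, and for each $C\in\mathrm{Ty}(\Gamma.A.A^+.\mathrm{Id}_A)$ and $d\colon\Gamma.A\to\Gamma.A.A^+.\mathrm{Id}_A.C$ with $\pi_Cd=r_A$ a map $J(C,d)$ with $J(C,d)r_A=d$, $\pi_CJ(C,d)=1$; and for every $f\colon\Delta\to\Gamma$, $\mathrm{Id}_A[f^{++}]=\mathrm{Id}_{A[f]}$, $f^{+++}r_{A[f]}=r_Af^+$, and $f^{++++}J(C[f^{+++}],d')=J(C,d)f^{+++}$,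 where $d'$ is the map into the pullback induced by $df^+$ and $r_{A[f]}$, and $f^{+},f^{++},\dots$ denote the induced maps between iterated extensions. -}

module Defs where

open import Level using (Level; _⊔_) renaming (suc to lsuc)
open import Relation.Binary.PropositionalEquality
  using (_≡_; refl; sym; trans; cong; module ≡-Reasoning)

record Category (o ℓ : Level) : Set (lsuc (o ⊔ ℓ)) where
  infixr 9 _∘_
  field
    Obj : Set o
    Hom : Obj → Obj → Set ℓ
    id  : ∀ {A} → Hom A A
    _∘_ : ∀ {A B C} → Hom B C → Hom A B → Hom A C
    identityˡ : ∀ {A B} {f : Hom A B} → id ∘ f ≡ f
    identityʳ : ∀ {A B} {f : Hom A B} → f ∘ id ≡ f
    assoc : ∀ {A B C D} {f : Hom A B} {g : Hom B C} {h : Hom C D} →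
            (h ∘ g) ∘ f ≡ h ∘ (g ∘ f)

module _ {o ℓ : Level} (𝒞 : Category o ℓ) where
  open Category 𝒞

  record IsPullback {W A B C : Obj} (f : Hom A C) (g : Hom B C)
                    (h : Hom W A) (k : Hom W B) : Set (o ⊔ ℓ) where
    field
      commute : f ∘ h ≡ g ∘ k
      ⟨_,_⟩  : ∀ {Z} (u : Hom Z A) (v : Hom Z B) → .(f ∘ u ≡ g ∘ v) → Hom Z W
      β₁     : ∀ {Z} (u : Hom Z A) (v : Hom Z B) (e : f ∘ u ≡ g ∘ v) → h ∘ ⟨ u , v ⟩ e ≡ u
      β₂     : ∀ {Z} (u : Hom Z A) (v : Hom Z B) (e : f ∘ u ≡ g ∘ v) → k ∘ ⟨ u , v ⟩ e ≡ v
      unique : ∀ {Z} (u : Hom Z A) (v : Hom Z B) (e : f ∘ u ≡ g ∘ v) (w : Hom Z W) →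
               h ∘ w ≡ u → k ∘ w ≡ v → w ≡ ⟨ u , v ⟩ e

  record Pullback {A B C : Obj} (f : Hom A C) (g : Hom B C) : Set (o ⊔ ℓ) where
    field
      P  : Obj
      p₁ : Hom P A
      p₂ : Hom P B
      isPullback : IsPullback f g p₁ p₂
    open IsPullback isPullback public

  record Terminal : Set (o ⊔ ℓ) where
    field
      ⊤ : Obj
      ! : ∀ {A} → Hom A ⊤
      !-unique : ∀ {A} (h : Hom A ⊤) → h ≡ !

  record FinitelyComplete : Set (o ⊔ ℓ) where
    field
      terminal : Terminal
      pullback : ∀ {A B C} (f : Hom A C) (g : Hom B C) → Pullback f g

  record ClovenWFS : Set (o ⊔ ℓ) where
    field
      P   : ∀ {X Y} → Hom X Y → Obj
      lam : ∀ {X Y} (f : Hom X Y) → Hom X (P f)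
      rho : ∀ {X Y} (f : Hom X Y) → Hom (P f) Y
      factor : ∀ {X Y} (f : Hom X Y) → rho f ∘ lam f ≡ f
      Pm : ∀ {X Y X' Y'} (f : Hom X Y) (g : Hom X' Y') (h : Hom X X') (k : Hom Y Y') →
           .(g ∘ h ≡ k ∘ f) → Hom (P f) (P g)
      Pm-lam : ∀ {X Y X' Y'} (f : Hom X Y) (g : Hom X' Y') (h : Hom X X') (k : Hom Y Y')
               (sq : g ∘ h ≡ k ∘ f) → Pm f g h k sq ∘ lam f ≡ lam g ∘ h
      Pm-rho : ∀ {X Y X' Y'} (f : Hom X Y) (g : Hom X' Y') (h : Hom X X') (k : Hom Y Y')
               (sq : g ∘ h ≡ k ∘ f) → rho g ∘ Pm f g h k sq ≡ k ∘ rho f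
      Pm-id  : ∀ {X Y} (f : Hom X Y) (sq : f ∘ id ≡ id ∘ f) → Pm f f id id sq ≡ id
      Pm-∘   : ∀ {X Y X' Y' X'' Y''} (f : Hom X Y) (g : Hom X' Y') (e : Hom X'' Y'')
               (h : Hom X X') (k : Hom Y Y') (h' : Hom X' X'') (k' : Hom Y' Y'')
               (sq₁ : g ∘ h ≡ k ∘ f) (sq₂ : e ∘ h' ≡ k' ∘ g)
               (sq₃ : e ∘ (h' ∘ h) ≡ (k' ∘ k) ∘ f) →
               Pm f e (h' ∘ h) (k' ∘ k) sq₃ ≡ Pm g e h' k' sq₂ ∘ Pm f g h k sq₁
      σ : ∀ {X Y} (f : Hom X Y) → Hom (P f) (P (lam f))
      π : ∀ {X Y} (f : Hom X Y) → Hom (P (rho f)) (P f)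
      σ-lam : ∀ {X Y} (f : Hom X Y) → σ f ∘ lam f ≡ lam (lam f)
      σ-rho : ∀ {X Y} (f : Hom X Y) → rho (lam f) ∘ σ f ≡ id
      π-lam : ∀ {X Y} (f : Hom X Y) → π f ∘ lam (rho f) ≡ id
      π-rho : ∀ {X Y} (f : Hom X Y) → rho f ∘ π f ≡ rho (rho f)

  module _ (FC : FinitelyComplete) (W : ClovenWFS) where
    open ClovenWFS W
    open FinitelyComplete FC

    record ClovenL {X Y} (f : Hom X Y) : Set ℓ where
      field
        s   : Hom Y (P f)
        s-f : s ∘ f ≡ lam f
        s-ρ : rho f ∘ s ≡ id

    record ClovenR {X Y} (f : Hom X Y) : Set ℓ where
      field
        p   : Hom (P f) X
        p-λ : p ∘ lam f ≡ id
        p-ρ : f ∘ p ≡ rho f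

    record LMor {X Y X' Y'} {f : Hom X Y} {g : Hom X' Y'}
                (S : ClovenL f) (T : ClovenL g) (h : Hom X X') (k : Hom Y Y') : Set ℓ where
      field
        sq     : g ∘ h ≡ k ∘ f
        compat : Pm f g h k sq ∘ ClovenL.s S ≡ ClovenL.s T ∘ k

    record RMor {X Y X' Y'} {f : Hom X Y} {g : Hom X' Y'}
                (S : ClovenR f) (T : ClovenR g) (h : Hom X X') (k : Hom Y Y') : Set ℓ where
      field
        sq     : g ∘ h ≡ k ∘ f
        compat : ClovenR.p T ∘ Pm f g h k sq ≡ h ∘ ClovenR.p S

    KP : ∀ {X Γ} (x : Hom X Γ) → Pullback x x
    KP x = pullback x x

    diag : ∀ {X Γ} (x : Hom X Γ) → Hom X (Pullback.P (KP x))
    diag x = Pullback.⟨_,_⟩ (KP x) id id refl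

    pairmap : ∀ {X Γ Y Δ} (x : Hom X Γ) (y : Hom Y Δ) (f : Hom X Y) (g : Hom Γ Δ) →
              y ∘ f ≡ g ∘ x → Hom (Pullback.P (KP x)) (Pullback.P (KP y))
    pairmap x y f g sq =
      Pullback.⟨_,_⟩ (KP y) (f ∘ Pullback.p₁ (KP x)) (f ∘ Pullback.p₂ (KP x)) eq
      where
      open ≡-Reasoning
      p₁ = Pullback.p₁ (KP x)
      p₂ = Pullback.p₂ (KP x)
      eq : y ∘ (f ∘ p₁) ≡ y ∘ (f ∘ p₂)
      eq = begin
        y ∘ (f ∘ p₁)   ≡⟨ sym assoc ⟩
        (y ∘ f) ∘ p₁   ≡⟨ cong (_∘ p₁) sq ⟩
        (g ∘ x) ∘ p₁   ≡⟨ assoc ⟩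
        g ∘ (x ∘ p₁)   ≡⟨ cong (g ∘_) (Pullback.commute (KP x)) ⟩
        g ∘ (x ∘ p₂)   ≡⟨ sym assoc ⟩
        (g ∘ x) ∘ p₂   ≡⟨ cong (_∘ p₂) (sym sq) ⟩
        (y ∘ f) ∘ p₂   ≡⟨ assoc ⟩
        y ∘ (f ∘ p₂)   ∎

    record DiagonalFactorisations : Set (o ⊔ ℓ) where
      field
        I  : ∀ {X Γ} (x : Hom X Γ) → ClovenR x → Obj
        i  : ∀ {X Γ} (x : Hom X Γ) (R : ClovenR x) → Hom X (I x R)
        j  : ∀ {X Γ} (x : Hom X Γ) (R : ClovenR x) → Hom (I x R) (Pullback.P (KP x))
        factor-diag : ∀ {X Γ} (x : Hom X Γ) (R : ClovenR x) → j x R ∘ i x R ≡ diag x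
        iL : ∀ {X Γ} (x : Hom X Γ) (R : ClovenR x) → ClovenL (i x R)
        jR : ∀ {X Γ} (x : Hom X Γ) (R : ClovenR x) → ClovenR (j x R)

    record Functorial (D : DiagonalFactorisations) : Set (o ⊔ ℓ) where
      open DiagonalFactorisations D
      field
        Imap : ∀ {X Γ Y Δ} {x : Hom X Γ} {y : Hom Y Δ} {Rx : ClovenR x} {Ry : ClovenR y}
               (f : Hom X Y) (g : Hom Γ Δ) → .(RMor Rx Ry f g) → Hom (I x Rx) (I y Ry)
        Imap-L : ∀ {X Γ Y Δ} {x : Hom X Γ} {y : Hom Y Δ} {Rx : ClovenR x} {Ry : ClovenR y}
                 (f : Hom X Y) (g : Hom Γ Δ) (m : RMor Rx Ry f g) →
                 LMor (iL x Rx) (iL y Ry) f (Imap f g m)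
        Imap-R : ∀ {X Γ Y Δ} {x : Hom X Γ} {y : Hom Y Δ} {Rx : ClovenR x} {Ry : ClovenR y}
                 (f : Hom X Y) (g : Hom Γ Δ) (m : RMor Rx Ry f g) →
                 RMor (jR x Rx) (jR y Ry) (Imap f g m) (pairmap x y f g (RMor.sq m))
        Imap-id : ∀ {X Γ} {x : Hom X Γ} {Rx : ClovenR x} (m : RMor Rx Rx id id) →
                  Imap id id m ≡ id
        Imap-∘ : ∀ {X Γ Y Δ Z Θ} {x : Hom X Γ} {y : Hom Y Δ} {z : Hom Z Θ}
                 {Rx : ClovenR x} {Ry : ClovenR y} {Rz : ClovenR z}
                 (f : Hom X Y) (g : Hom Γ Δ) (f' : Hom Y Z) (g' : Hom Δ Θ)
                 (m₁ : RMor Rx Ry f g) (m₂ : RMor Ry Rz f' g')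
                 (m₃ : RMor Rx Rz (f' ∘ f) (g' ∘ g)) →
                 Imap (f' ∘ f) (g' ∘ g) m₃ ≡ Imap f' g' m₂ ∘ Imap f g m₁

    record Stable (D : DiagonalFactorisations) (F : Functorial D) : Set (o ⊔ ℓ) where
      open DiagonalFactorisations D
      open Functorial F
      field
        stable : ∀ {X Γ Y Δ} {x : Hom X Γ} {y : Hom Y Δ} {Rx : ClovenR x} {Ry : ClovenR y}
                 (f : Hom X Y) (g : Hom Γ Δ) (m : RMor Rx Ry f g) →
                 IsPullback y g f x →
                 IsPullback (j y Ry) (pairmap x y f g (RMor.sq m)) (Imap f g m) (j x Rx)

    record Ty (Γ : Obj) : Set (o ⊔ ℓ) where
      constructor ty
      field
        dom  : Obj
        proj : Hom dom Γ
        str  : ClovenR proj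
    open Ty public

    subPb : ∀ {Δ Γ} (A : Ty Γ) (f : Hom Δ Γ) → Pullback (proj A) f
    subPb A f = pullback (proj A) f

    _⁺ : ∀ {Δ Γ} (f : Hom Δ Γ) {A : Ty Γ} → Hom (Pullback.P (subPb A f)) (dom A)
    (f ⁺) {A} = Pullback.p₁ (subPb A f)

    subStr : ∀ {Δ Γ} (A : Ty Γ) (f : Hom Δ Γ) → ClovenR (Pullback.p₂ (subPb A f))
    subStr {Δ} {Γ} A f = record { p = py ; p-λ = pλ ; p-ρ = pρ }
      where
      open ≡-Reasoning
      x  = proj A
      pA = ClovenR.p (str A)
      Q  = subPb A f
      open Pullback Q using (p₁; p₂; commute; β₁; β₂; unique) renaming (⟨_,_⟩ to ⟪_,_⟫)
      y = p₂
      Pmy = Pm y x p₁ f commute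
      e : x ∘ (pA ∘ Pmy) ≡ f ∘ rho y
      e = begin
        x ∘ (pA ∘ Pmy)  ≡⟨ sym assoc ⟩
        (x ∘ pA) ∘ Pmy  ≡⟨ cong (_∘ Pmy) (ClovenR.p-ρ (str A)) ⟩
        rho x ∘ Pmy     ≡⟨ Pm-rho y x p₁ f commute ⟩
        f ∘ rho y       ∎
      py : Hom (P y) (Pullback.P Q)
      py = ⟪ pA ∘ Pmy , rho y ⟫ e
      pρ : y ∘ py ≡ rho y
      pρ = β₂ (pA ∘ Pmy) (rho y) e
      e₁ : p₁ ∘ (py ∘ lam y) ≡ p₁
      e₁ = begin
        p₁ ∘ (py ∘ lam y)       ≡⟨ sym assoc ⟩
        (p₁ ∘ py) ∘ lam y       ≡⟨ cong (_∘ lam y) (β₁ (pA ∘ Pmy) (rho y) e) ⟩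
        (pA ∘ Pmy) ∘ lam y      ≡⟨ assoc ⟩
        pA ∘ (Pmy ∘ lam y)      ≡⟨ cong (pA ∘_) (Pm-lam y x p₁ f commute) ⟩
        pA ∘ (lam x ∘ p₁)       ≡⟨ sym assoc ⟩
        (pA ∘ lam x) ∘ p₁       ≡⟨ cong (_∘ p₁) (ClovenR.p-λ (str A)) ⟩
        id ∘ p₁                 ≡⟨ identityˡ ⟩
        p₁                      ∎
      e₂ : p₂ ∘ (py ∘ lam y) ≡ p₂
      e₂ = begin
        p₂ ∘ (py ∘ lam y)       ≡⟨ sym assoc ⟩
        (p₂ ∘ py) ∘ lam y       ≡⟨ cong (_∘ lam y) pρ ⟩
        rho y ∘ lam y           ≡⟨ factor y ⟩
        p₂                      ∎
      pλ : py ∘ lam y ≡ id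
      pλ = trans (unique p₁ p₂ commute (py ∘ lam y) e₁ e₂)
                 (sym (unique p₁ p₂ commute id identityʳ identityʳ))

    _[_] : ∀ {Δ Γ} (A : Ty Γ) (f : Hom Δ Γ) → Ty Δ
    A [ f ] = ty (Pullback.P (subPb A f)) (Pullback.p₂ (subPb A f)) (subStr A f)

    _⁺ᵀ : ∀ {Γ} (A : Ty Γ) → Ty (dom A)
    A ⁺ᵀ = A [ proj A ]

    ext² : ∀ {Γ} (A : Ty Γ) → Obj
    ext² A = dom (A ⁺ᵀ)

    δ : ∀ {Γ} (A : Ty Γ) → Hom (dom A) (ext² A)
    δ A = diag (proj A)

    _⁺⁺ : ∀ {Δ Γ} (f : Hom Δ Γ) {A : Ty Γ} → Hom (ext² (A [ f ])) (ext² A)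
    (f ⁺⁺) {A} = pairmap (proj (A [ f ])) (proj A) ((f ⁺) {A}) f (Pullback.commute (subPb A f))

    -- Stability Id_A[f⁺⁺] = Id_{A[f]} is expressed up to the canonical
    -- identification of pullbacks: f⁺⁺⁺ (written Id⁺) exhibits Id_{A[f]}
    -- as a pullback of Id_A along f⁺⁺ with (f⁺⁺⁺, f⁺⁺) a morphism of cloven
    -- R-maps (i.e. Id_{A[f]} is Id_A[f⁺⁺] with its induced structure).

    record IdentityTypes : Set (o ⊔ ℓ) where
      field
        Id  : ∀ {Γ} (A : Ty Γ) → Ty (ext² A)
        r   : ∀ {Γ} (A : Ty Γ) → Hom (dom A) (dom (Id A))
        r-π : ∀ {Γ} (A : Ty Γ) → proj (Id A) ∘ r A ≡ δ A
        J   : ∀ {Γ} {A : Ty Γ} (C : Ty (dom (Id A))) (d : Hom (dom A) (dom C)) →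
              .(proj C ∘ d ≡ r A) → Hom (dom (Id A)) (dom C)
        J-r : ∀ {Γ} {A : Ty Γ} (C : Ty (dom (Id A))) (d : Hom (dom A) (dom C))
              (e : proj C ∘ d ≡ r A) → J C d e ∘ r A ≡ d
        J-π : ∀ {Γ} {A : Ty Γ} (C : Ty (dom (Id A))) (d : Hom (dom A) (dom C))
              (e : proj C ∘ d ≡ r A) → proj C ∘ J C d e ≡ id
        Id⁺ : ∀ {Δ Γ} (f : Hom Δ Γ) (A : Ty Γ) → Hom (dom (Id (A [ f ]))) (dom (Id A))
        Id⁺-pb : ∀ {Δ Γ} (f : Hom Δ Γ) (A : Ty Γ) →
                 IsPullback (proj (Id A)) ((f ⁺⁺) {A}) (Id⁺ f A) (proj (Id (A [ f ])))
        Id⁺-R  : ∀ {Δ Γ} (f : Hom Δ Γ) (A : Ty Γ) →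
                 RMor (str (Id (A [ f ]))) (str (Id A)) (Id⁺ f A) ((f ⁺⁺) {A})
        r-stable : ∀ {Δ Γ} (f : Hom Δ Γ) (A : Ty Γ) →
                   Id⁺ f A ∘ r (A [ f ]) ≡ r A ∘ (f ⁺) {A}
        J-stable : ∀ {Δ Γ} (f : Hom Δ Γ) (A : Ty Γ)
                   (C : Ty (dom (Id A))) (d : Hom (dom A) (dom C)) (e : proj C ∘ d ≡ r A)
                   (q : proj C ∘ (d ∘ (f ⁺) {A}) ≡ Id⁺ f A ∘ r (A [ f ])) →
                   let d' = Pullback.⟨_,_⟩ (subPb C (Id⁺ f A)) (d ∘ (f ⁺) {A}) (r (A [ f ])) q in
                   (e' : proj (C [ Id⁺ f A ]) ∘ d' ≡ r (A [ f ])) →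
                   (Id⁺ f A ⁺) {C} ∘ J (C [ Id⁺ f A ]) d' e' ≡ J C d e ∘ Id⁺ f A

{-# OPTIONS --safe #-}
module Submission where

-- Id_A is the middle object of the chosen factorisation of the diagonal of A, r_A its cloven
-- L-part, and J(C, d) the canonical filler of the square (d, 1) from the cloven L-map r_A to the
-- cloven R-map π_C.  Substitution is a morphism of cloven R-maps, so functoriality of the
-- diagonal factorisations transports Id, r (as a morphism of L-maps) and the R-structure of Id,
-- stability makes Id_{A[f]} a pullback of Id_A, and fillers are natural in morphisms of cloven
-- L- and R-maps, which gives stability of J.

open import Level using (Level)
open import Relation.Binary.PropositionalEquality
  using (_≡_; refl; sym; trans; cong; module ≡-Reasoning)
open import Defs

module Fillers {o ℓ : Level} (𝒞 : Category o ℓ) (FC : FinitelyComplete 𝒞) (W : ClovenWFS 𝒞) where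
  open Category 𝒞
  open ClovenWFS W
  open ≡-Reasoning

  Pm-cong : ∀ {X Y X' Y'} (f : Hom X Y) (g : Hom X' Y') {h h' : Hom X X'} {k k' : Hom Y Y'} →
            h ≡ h' → k ≡ k' → .(sq : g ∘ h ≡ k ∘ f) .(sq' : g ∘ h' ≡ k' ∘ f) →
            Pm f g h k sq ≡ Pm f g h' k' sq'
  Pm-cong f g refl refl sq sq' = refl

  square-paste : ∀ {X Y X' Y' X'' Y''} {f : Hom X Y} {g : Hom X' Y'} {e : Hom X'' Y''}
                 {h : Hom X X'} {k : Hom Y Y'} {h' : Hom X' X''} {k' : Hom Y' Y''} →
                 g ∘ h ≡ k ∘ f → e ∘ h' ≡ k' ∘ g → e ∘ (h' ∘ h) ≡ (k' ∘ k) ∘ f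
  square-paste {f = f} {g} {e} {h} {k} {h'} {k'} sq₁ sq₂ = begin
    e ∘ (h' ∘ h)  ≡⟨ sym assoc ⟩
    (e ∘ h') ∘ h  ≡⟨ cong (_∘ h) sq₂ ⟩
    (k' ∘ g) ∘ h  ≡⟨ assoc ⟩
    k' ∘ (g ∘ h)  ≡⟨ cong (k' ∘_) sq₁ ⟩
    k' ∘ (k ∘ f)  ≡⟨ sym assoc ⟩
    (k' ∘ k) ∘ f  ∎

  Pm-paste : ∀ {X Y X' Y' X'' Y''} (f : Hom X Y) (g : Hom X' Y') (e : Hom X'' Y'')
             {h : Hom X X'} {k : Hom Y Y'} {h' : Hom X' X''} {k' : Hom Y' Y''}
             (sq₁ : g ∘ h ≡ k ∘ f) (sq₂ : e ∘ h' ≡ k' ∘ g) →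
             Pm g e h' k' sq₂ ∘ Pm f g h k sq₁ ≡ Pm f e (h' ∘ h) (k' ∘ k) (square-paste sq₁ sq₂)
  Pm-paste f g e {h} {k} {h'} {k'} sq₁ sq₂ =
    sym (Pm-∘ f g e h k h' k' sq₁ sq₂ (square-paste sq₁ sq₂))

  fill : ∀ {A B X Y} {i : Hom A B} {c : Hom X Y} →
         ClovenL 𝒞 FC W i → ClovenR 𝒞 FC W c →
         (u : Hom A X) (v : Hom B Y) → .(c ∘ u ≡ v ∘ i) → Hom B X
  fill {i = i} {c} S T u v sq = ClovenR.p T ∘ (Pm i c u v sq ∘ ClovenL.s S)

  fill-lam : ∀ {A B X Y} {i : Hom A B} {c : Hom X Y}
             (S : ClovenL 𝒞 FC W i) (T : ClovenR 𝒞 FC W c)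
             (u : Hom A X) (v : Hom B Y) (sq : c ∘ u ≡ v ∘ i) →
             fill S T u v sq ∘ i ≡ u
  fill-lam {i = i} {c} S T u v sq = begin
    (p ∘ (Pmuv ∘ s)) ∘ i  ≡⟨ assoc ⟩
    p ∘ ((Pmuv ∘ s) ∘ i)  ≡⟨ cong (p ∘_) assoc ⟩
    p ∘ (Pmuv ∘ (s ∘ i))  ≡⟨ cong (λ z → p ∘ (Pmuv ∘ z)) (ClovenL.s-f S) ⟩
    p ∘ (Pmuv ∘ lam i)    ≡⟨ cong (p ∘_) (Pm-lam i c u v sq) ⟩
    p ∘ (lam c ∘ u)       ≡⟨ sym assoc ⟩
    (p ∘ lam c) ∘ u       ≡⟨ cong (_∘ u) (ClovenR.p-λ T) ⟩
    id ∘ u                ≡⟨ identityˡ ⟩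
    u                     ∎
    where
    p = ClovenR.p T
    s = ClovenL.s S
    Pmuv = Pm i c u v sq

  fill-rho : ∀ {A B X Y} {i : Hom A B} {c : Hom X Y}
             (S : ClovenL 𝒞 FC W i) (T : ClovenR 𝒞 FC W c)
             (u : Hom A X) (v : Hom B Y) (sq : c ∘ u ≡ v ∘ i) →
             c ∘ fill S T u v sq ≡ v
  fill-rho {i = i} {c} S T u v sq = begin
    c ∘ (p ∘ (Pmuv ∘ s))  ≡⟨ sym assoc ⟩
    (c ∘ p) ∘ (Pmuv ∘ s)  ≡⟨ cong (_∘ (Pmuv ∘ s)) (ClovenR.p-ρ T) ⟩
    rho c ∘ (Pmuv ∘ s)    ≡⟨ sym assoc ⟩
    (rho c ∘ Pmuv) ∘ s    ≡⟨ cong (_∘ s) (Pm-rho i c u v sq) ⟩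
    (v ∘ rho i) ∘ s       ≡⟨ assoc ⟩
    v ∘ (rho i ∘ s)       ≡⟨ cong (v ∘_) (ClovenL.s-ρ S) ⟩
    v ∘ id                ≡⟨ identityʳ ⟩
    v                     ∎
    where
    p = ClovenR.p T
    s = ClovenL.s S
    Pmuv = Pm i c u v sq

  fill-natural : ∀ {A B X Y A' B' X' Y'} {i : Hom A B} {c : Hom X Y} {i' : Hom A' B'} {c' : Hom X' Y'}
                 {S : ClovenL 𝒞 FC W i} {T : ClovenR 𝒞 FC W c}
                 {S' : ClovenL 𝒞 FC W i'} {T' : ClovenR 𝒞 FC W c'}
                 {h : Hom A' A} {k : Hom B' B} {h' : Hom X' X} {k' : Hom Y' Y} →
                 LMor 𝒞 FC W S' S h k → RMor 𝒞 FC W T' T h' k' →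
                 (u : Hom A X) (v : Hom B Y) (u' : Hom A' X') (v' : Hom B' Y')
                 (sq : c ∘ u ≡ v ∘ i) (sq' : c' ∘ u' ≡ v' ∘ i') →
                 h' ∘ u' ≡ u ∘ h → k' ∘ v' ≡ v ∘ k →
                 h' ∘ fill S' T' u' v' sq' ≡ fill S T u v sq ∘ k
  fill-natural {i = i} {c} {i'} {c'} {S} {T} {S'} {T'} {h} {k} {h'} {k'}
               L R u v u' v' sq sq' hu kv = begin
    h' ∘ (p' ∘ (Pm' ∘ s'))       ≡⟨ sym assoc ⟩
    (h' ∘ p') ∘ (Pm' ∘ s')       ≡⟨ cong (_∘ (Pm' ∘ s')) (sym (RMor.compat R)) ⟩
    (p ∘ PmR) ∘ (Pm' ∘ s')       ≡⟨ assoc ⟩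
    p ∘ (PmR ∘ (Pm' ∘ s'))       ≡⟨ cong (p ∘_) (sym assoc) ⟩
    p ∘ ((PmR ∘ Pm') ∘ s')       ≡⟨ cong (λ z → p ∘ (z ∘ s')) across ⟩
    p ∘ ((Pmuv ∘ PmL) ∘ s')      ≡⟨ cong (p ∘_) assoc ⟩
    p ∘ (Pmuv ∘ (PmL ∘ s'))      ≡⟨ cong (λ z → p ∘ (Pmuv ∘ z)) (LMor.compat L) ⟩
    p ∘ (Pmuv ∘ (s ∘ k))         ≡⟨ cong (p ∘_) (sym assoc) ⟩
    p ∘ ((Pmuv ∘ s) ∘ k)         ≡⟨ sym assoc ⟩
    (p ∘ (Pmuv ∘ s)) ∘ k         ∎
    where
    p = ClovenR.p T
    p' = ClovenR.p T'
    s = ClovenL.s S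
    s' = ClovenL.s S'
    Pmuv = Pm i c u v sq
    Pm' = Pm i' c' u' v' sq'
    PmR = Pm c' c h' k' (RMor.sq R)
    PmL = Pm i' i h k (LMor.sq L)
    across : PmR ∘ Pm' ≡ Pmuv ∘ PmL
    across = begin
      PmR ∘ Pm'
        ≡⟨ Pm-paste i' c' c sq' (RMor.sq R) ⟩
      Pm i' c (h' ∘ u') (k' ∘ v') (square-paste sq' (RMor.sq R))
        ≡⟨ Pm-cong i' c hu kv _ (square-paste (LMor.sq L) sq) ⟩
      Pm i' c (u ∘ h) (v ∘ k) (square-paste (LMor.sq L) sq)
        ≡⟨ sym (Pm-paste i' i c (LMor.sq L) sq) ⟩
      Pmuv ∘ PmL ∎

module IdentityTypesFromDiagonals {o ℓ : Level} (𝒞 : Category o ℓ) (FC : FinitelyComplete 𝒞)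
    (W : ClovenWFS 𝒞) (D : DiagonalFactorisations 𝒞 FC W)
    (F : Functorial 𝒞 FC W D) (S : Stable 𝒞 FC W D F) where
  open Category 𝒞
  open DiagonalFactorisations D
  open Functorial F
  open Stable S
  open ClovenWFS W using (Pm; rho; Pm-rho)
  open Fillers 𝒞 FC W

  sub-RMor : ∀ {Δ Γ} (A : Ty 𝒞 FC W Γ) (f : Hom Δ Γ) →
             RMor 𝒞 FC W (str (_[_] 𝒞 FC W A f)) (str A) (_⁺ 𝒞 FC W f {A}) f
  -- subStr defines the structure map of A[f] as the pairing ⟨p_A ∘ P(f⁺, f), ρ⟩ into the pullback.
  sub-RMor A f = record
    { sq = Pullback.commute Q
    ; compat = sym (Pullback.β₁ Q (ClovenR.p (str A) ∘ Pmy) (rho y) e)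
    }
    where
    Q = subPb 𝒞 FC W A f
    y = Pullback.p₂ Q
    Pmy = Pm y (proj A) (Pullback.p₁ Q) f (Pullback.commute Q)
    e : proj A ∘ (ClovenR.p (str A) ∘ Pmy) ≡ f ∘ rho y
    e = trans (sym assoc) (trans (cong (_∘ Pmy) (ClovenR.p-ρ (str A)))
                                 (Pm-rho y (proj A) (Pullback.p₁ Q) f (Pullback.commute Q)))

  Id : ∀ {Γ} (A : Ty 𝒞 FC W Γ) → Ty 𝒞 FC W (ext² 𝒞 FC W A)
  Id A = ty (I (proj A) (str A)) (j (proj A) (str A)) (jR (proj A) (str A))

  r : ∀ {Γ} (A : Ty 𝒞 FC W Γ) → Hom (dom A) (dom (Id A))
  r A = i (proj A) (str A)

  J-square : ∀ {Γ} {A : Ty 𝒞 FC W Γ} (C : Ty 𝒞 FC W (dom (Id A))) (d : Hom (dom A) (dom C)) →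
             proj C ∘ d ≡ r A → proj C ∘ d ≡ id ∘ r A
  J-square C d e = trans e (sym identityˡ)

  J : ∀ {Γ} {A : Ty 𝒞 FC W Γ} (C : Ty 𝒞 FC W (dom (Id A))) (d : Hom (dom A) (dom C)) →
      .(proj C ∘ d ≡ r A) → Hom (dom (Id A)) (dom C)
  J {A = A} C d e = fill (iL (proj A) (str A)) (str C) d id (J-square C d e)

  Id⁺ : ∀ {Δ Γ} (f : Hom Δ Γ) (A : Ty 𝒞 FC W Γ) → Hom (dom (Id (_[_] 𝒞 FC W A f))) (dom (Id A))
  Id⁺ f A = Imap (_⁺ 𝒞 FC W f {A}) f (sub-RMor A f)

  r-LMor : ∀ {Δ Γ} (f : Hom Δ Γ) (A : Ty 𝒞 FC W Γ) →
           LMor 𝒞 FC W (iL _ (str (_[_] 𝒞 FC W A f))) (iL (proj A) (str A))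
                       (_⁺ 𝒞 FC W f {A}) (Id⁺ f A)
  r-LMor f A = Imap-L (_⁺ 𝒞 FC W f {A}) f (sub-RMor A f)

  J-stable : ∀ {Δ Γ} (f : Hom Δ Γ) (A : Ty 𝒞 FC W Γ)
             (C : Ty 𝒞 FC W (dom (Id A))) (d : Hom (dom A) (dom C)) (e : proj C ∘ d ≡ r A)
             (q : proj C ∘ (d ∘ _⁺ 𝒞 FC W f {A}) ≡ Id⁺ f A ∘ r (_[_] 𝒞 FC W A f)) →
             let d' = Pullback.⟨_,_⟩ (subPb 𝒞 FC W C (Id⁺ f A))
                                       (d ∘ _⁺ 𝒞 FC W f {A}) (r (_[_] 𝒞 FC W A f)) q in
             (e' : proj (_[_] 𝒞 FC W C (Id⁺ f A)) ∘ d' ≡ r (_[_] 𝒞 FC W A f)) →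
             _⁺ 𝒞 FC W (Id⁺ f A) {C} ∘ J (_[_] 𝒞 FC W C (Id⁺ f A)) d' e' ≡ J C d e ∘ Id⁺ f A
  J-stable f A C d e q e' =
    fill-natural (r-LMor f A) (sub-RMor C (Id⁺ f A)) d id _ id
      (J-square C d e) (J-square (_[_] 𝒞 FC W C (Id⁺ f A)) _ e')
      (Pullback.β₁ (subPb 𝒞 FC W C (Id⁺ f A)) _ _ q)
      (trans identityʳ (sym identityˡ))

  identityTypes : IdentityTypes 𝒞 FC W
  identityTypes = record
    { Id = Id
    ; r = r
    ; r-π = λ A → factor-diag (proj A) (str A)
    ; J = J
    ; J-r = λ {_} {A} C d e → fill-lam (iL (proj A) (str A)) (str C) d id (J-square C d e)
    ; J-π = λ {_} {A} C d e → fill-rho (iL (proj A) (str A)) (str C) d id (J-square C d e)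
    ; Id⁺ = Id⁺
    ; Id⁺-pb = λ f A → stable _ f (sub-RMor A f) (Pullback.isPullback (subPb 𝒞 FC W A f))
    ; Id⁺-R = λ f A → Imap-R _ f (sub-RMor A f)
    ; r-stable = λ f A → sym (LMor.sq (r-LMor f A))
    ; J-stable = J-stable
    }

proposition3p11 : ∀ {o ℓ : Level} (𝒞 : Category o ℓ) (FC : FinitelyComplete 𝒞)
    (W : ClovenWFS 𝒞) (D : DiagonalFactorisations 𝒞 FC W)
    (F : Functorial 𝒞 FC W D) → Stable 𝒞 FC W D F →
    IdentityTypes 𝒞 FC W
proposition3p11 𝒞 FC W D F S = IdentityTypesFromDiagonals.identityTypes 𝒞 FC W D F S
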